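{- Let $n\ge 2$ be an integer. The number of pairs of disjoint matrices in $\Sigma_{n^2}$ equals the number of pairs of disjoint matrices in $\Pi_n$.
   Context: An $n^2\times n^2$ S-permutation matrix is an $n^2\times n^2$ permutation matrix which, when partitioned into $n^2$ consecutive square $n\times n$ blocks $A_{st}$, $1\le s,t\le n$, has exactly one entry equal to $1$ in each block; $\Sigma_{n^2}$ is the set of all of them. Two S-permutation matrices $A=[a_{ij}]$, $B=[b_{ij}]$ are disjoint if there are no $i,j$ with $a_{ij}=b_{ij}=1$. $\Pi_n$ is the set of all $n\times n$ matrices whose entries are ordered pairs $\langle a,b\rangle$ with $a,b\in\{1,\dots,n\}$ such that in each row the first components form a permutation of $\{1,\dots,n\}$ and in each column the second components form a permutation of $\{1,\dots,n\}$. Two matrices $\pi'=[p'_{ij}],\pi''=[p''_{ij}]\in\Pi_n$ are disjoint if $p'_{ij}\ne p''_{ij}$ for all $i,j\in\{1,\dots,n\}$. -}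

module Defs where

open import Data.Nat using (ℕ; suc; _*_; _≡ᵇ_)
open import Data.Bool using (Bool; true; false; _∧_; not; if_then_else_)
open import Data.Fin using (Fin; combine)
open import Data.Fin.Properties using () renaming (_≟_ to _≟F_)
open import Data.List using (List; allFin; map; foldr)
open import Data.Nat.ListAction using (sum)
open import Data.Nat using (_+_)
open import Data.Product using (_×_; _,_; proj₁; proj₂)
open import Data.Vec using (Vec; lookup)
open import Relation.Nullary.Decidable using (⌊_⌋)

allF : {k : ℕ} → (Fin k → Bool) → Bool
allF {k} f = foldr (λ i b → f i ∧ b) true (allFin k)

countF : {k : ℕ} → (Fin k → Bool) → ℕ
countF {k} f = sum (map (λ i → if f i then 1 else 0) (allFin k))

exactlyOne : {k : ℕ} → (Fin k → Bool) → Bool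
exactlyOne f = countF f ≡ᵇ 1

-- 0/1 square matrices of size m (entries true = 1, false = 0)
BMat : ℕ → Set
BMat m = Vec (Vec Bool m) m

entry : {m : ℕ} → BMat m → Fin m → Fin m → Bool
entry A i j = lookup (lookup A i) j

isPermutationMatrix : {m : ℕ} → BMat m → Bool
isPermutationMatrix A =
  allF (λ i → exactlyOne (λ j → entry A i j)) ∧
  allF (λ j → exactlyOne (λ i → entry A i j))



-- number of 1-entries in block A_{st} (rows s*n+i, columns t*n+j, i j : Fin n)
blockCount : (n : ℕ) → BMat (n * n) → Fin n → Fin n → ℕ
blockCount n A s t =
  sum (map (λ i → countF {n} (λ j → entry A (combine s i) (combine t j))) (allFin n))

isSPermutationMatrix : (n : ℕ) → BMat (n * n) → Bool
isSPermutationMatrix n A =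
  isPermutationMatrix A ∧
  allF {n} (λ s → allF {n} (λ t → blockCount n A s t ≡ᵇ 1))

disjointB : {m : ℕ} → BMat m → BMat m → Bool
disjointB A B = allF (λ i → allF (λ j → not (entry A i j ∧ entry B i j)))

-- n×n matrices of ordered pairs ⟨a,b⟩, a b ∈ Fin n (Fin n stands for {1,…,n})
PMat : ℕ → Set
PMat n = Vec (Vec (Fin n × Fin n) n) n

pentry : {n : ℕ} → PMat n → Fin n → Fin n → Fin n × Fin n
pentry P i j = lookup (lookup P i) j

isΠ : (n : ℕ) → PMat n → Bool
isΠ n P =
  allF (λ i → allF (λ a → exactlyOne (λ j → ⌊ proj₁ (pentry P i j) ≟F a ⌋))) ∧
  allF (λ j → allF (λ b → exactlyOne (λ i → ⌊ proj₂ (pentry P i j) ≟F b ⌋)))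

pairEq : {n : ℕ} → Fin n × Fin n → Fin n × Fin n → Bool
pairEq (a , b) (c , d) = ⌊ a ≟F c ⌋ ∧ ⌊ b ≟F d ⌋

disjointΠ : {n : ℕ} → PMat n → PMat n → Bool
disjointΠ P Q = allF (λ i → allF (λ j → not (pairEq (pentry P i j) (pentry Q i j))))

module Submission where

-- A 0/1 matrix A of size n²×n² with exactly one 1 in every block A_st is the
-- same thing as the n×n matrix of pairs P = collapse A whose cell (s , t) records the
-- position ⟨i , j⟩ of that 1; conversely expand P puts a 1 at (s·n+i , t·n+j) exactly
-- when P_st = ⟨i , j⟩.  Under this correspondence row s·n+a of A has a single 1 iff
-- the first components of row s of P take the value a exactly once, and dually for
-- columns, so A ∈ Σ_{n²} iff P ∈ Π_n; a common 1 of two expansions is a common cell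
-- value, so disjointness corresponds as well.

open import Defs
open import Data.Bool using (Bool; true; false; T; _∧_; not; if_then_else_)
open import Data.Bool.Properties using (T-∧; T-≡; T-irrelevant; ⇔→≡)
open import Data.Empty using (⊥-elim)
open import Data.Fin using (Fin; zero; suc; combine; remQuot)
open import Data.Fin.Properties using (suc-injective; combine-surjective; remQuot-combine; *↔×)
  renaming (_≟_ to _≟F_)
import Data.List as List
open import Data.List using (map; foldr; allFin)
open import Data.List.Properties using (map-tabulate)
open import Data.Nat using (ℕ; zero; suc; pred; _+_; _*_; _≡ᵇ_; _≤_)
open import Data.Nat.ListAction using (sum)
open import Data.Nat.Properties using (≡ᵇ⇒≡; ≡⇒≡ᵇ; m+n≡0⇒m≡0; m+n≡0⇒n≡0)
open import Data.Product using (Σ; ∃; ∃!; _×_; _,_; proj₁; proj₂; swap)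
open import Data.Product.Properties using (×-≡,≡→≡; ×-≡,≡←≡)
open import Data.Vec using (Vec; lookup; tabulate)
open import Data.Vec.Properties using (lookup∘tabulate; tabulate∘lookup; tabulate-cong)
open import Function using (_∘_; id)
open import Function.Bundles using (_⇔_; mk⇔; Equivalence; _↔_; Inverse; _⤖_; mk↔ₛ′)
open import Function.Properties.Inverse using (↔⇒⤖)
open import Function.Related.Propositional using (module EquationalReasoning; Kind)
open import Relation.Binary.PropositionalEquality
open import Relation.Nullary using (¬_; Dec; yes; no)
open import Relation.Nullary.Decidable using (⌊_⌋; toWitness; fromWitness)

open Equivalence using (to; from)

T-allF : ∀ {k} {f : Fin k → Bool} → T (allF f) ⇔ (∀ i → T (f i))
T-allF = T-foldr-∧ id
  where
  T-foldr-∧ : ∀ {A : Set} {k} (g : Fin k → A) {f : A → Bool} →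
              T (foldr (λ x b → f x ∧ b) true (List.tabulate g)) ⇔ (∀ i → T (f (g i)))
  T-foldr-∧ {k = zero}  g = mk⇔ (λ _ ()) _
  T-foldr-∧ {k = suc k} g {f} = mk⇔
    (λ p → λ { zero → proj₁ (to ∧⇔ p) ; (suc i) → to rest (proj₂ (to ∧⇔ p)) i })
    (λ h → from ∧⇔ (h zero , from rest (h ∘ suc)))
    where
    rest = T-foldr-∧ (g ∘ suc) {f}
    ∧⇔ = T-∧ {f (g zero)} {foldr (λ x b → f x ∧ b) true (List.tabulate (g ∘ suc))}

sum≡0⇔ : ∀ {k} (g : Fin k → ℕ) → sum (List.tabulate g) ≡ 0 ⇔ (∀ i → g i ≡ 0)
sum≡0⇔ {zero}  g = mk⇔ (λ _ ()) (λ _ → refl)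
sum≡0⇔ {suc k} g = mk⇔
  (λ e → λ { zero → m+n≡0⇒m≡0 (g zero) e ; (suc i) → to rest (m+n≡0⇒n≡0 (g zero) e) i })
  (λ h → cong₂ _+_ (h zero) (from rest (h ∘ suc)))
  where rest = sum≡0⇔ (g ∘ suc)

SingleUnit : ∀ {k} → (Fin k → ℕ) → Fin k → Set
SingleUnit g i = g i ≡ 1 × (∀ j → j ≢ i → g j ≡ 0)

sum≡1⇔ : ∀ {k} (g : Fin k → ℕ) → sum (List.tabulate g) ≡ 1 ⇔ ∃ (SingleUnit g)
sum≡1⇔ g = mk⇔ (split g) (join g)
  where
  split : ∀ {k} (g : Fin k → ℕ) → sum (List.tabulate g) ≡ 1 → ∃ (SingleUnit g)
  split {suc k} g e with g zero in g₀
  ... | zero with split (g ∘ suc) e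
  ...   | i , gi , others = suc i , gi , λ { zero _ → g₀ ; (suc j) j≢i → others j (j≢i ∘ cong suc) }
  split {suc k} g e | suc zero =
    zero , g₀ , λ { zero 0≢0 → ⊥-elim (0≢0 refl) ; (suc j) _ → to (sum≡0⇔ (g ∘ suc)) (cong pred e) j }
  join : ∀ {k} (g : Fin k → ℕ) → ∃ (SingleUnit g) → sum (List.tabulate g) ≡ 1
  join g (zero , g₀ , others) = cong₂ _+_ g₀ (from (sum≡0⇔ (g ∘ suc)) (λ j → others (suc j) λ ()))
  join g (suc i , gi , others) =
    cong₂ _+_ (others zero λ ()) (join (g ∘ suc) (i , gi , λ j j≢i → others (suc j) (j≢i ∘ suc-injective)))

sum-over-allFin : ∀ {k} (g : Fin k → ℕ) → sum (map g (allFin k)) ≡ sum (List.tabulate g)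
sum-over-allFin g = cong sum (map-tabulate id g)

indicator : Bool → ℕ
indicator b = if b then 1 else 0

indicator≡1⇔ : ∀ b → indicator b ≡ 1 ⇔ T b
indicator≡1⇔ true  = mk⇔ _ (λ _ → refl)
indicator≡1⇔ false = mk⇔ (λ ()) (λ ())

indicator≡0⇔ : ∀ b → indicator b ≡ 0 ⇔ (¬ T b)
indicator≡0⇔ true  = mk⇔ (λ ()) (λ ¬t → ⊥-elim (¬t _))
indicator≡0⇔ false = mk⇔ (λ _ ()) (λ _ → refl)

module _ {k : ℕ} (f : Fin k → Bool) where

  countF≡sum : countF f ≡ sum (List.tabulate (indicator ∘ f))
  countF≡sum = sum-over-allFin (indicator ∘ f)

  countF≡0⇔ : countF f ≡ 0 ⇔ (∀ i → ¬ T (f i))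
  countF≡0⇔ = mk⇔
    (λ e i → to (indicator≡0⇔ (f i)) (to (sum≡0⇔ _) (trans (sym countF≡sum) e) i))
    (λ h → trans countF≡sum (from (sum≡0⇔ _) (λ i → from (indicator≡0⇔ (f i)) (h i))))

  countF≡1⇔ : countF f ≡ 1 ⇔ ∃! _≡_ (T ∘ f)
  countF≡1⇔ = mk⇔
    (λ e → unique (to (sum≡1⇔ _) (trans (sym countF≡sum) e)))
    (λ u → trans countF≡sum (from (sum≡1⇔ _) (single u)))
    where
    unique : ∃ (SingleUnit (indicator ∘ f)) → ∃! _≡_ (T ∘ f)
    unique (i , one , zeros) = i , to (indicator≡1⇔ (f i)) one , at-i
      where
      at-i : ∀ {j} → T (f j) → i ≡ j
      at-i {j} fj with i ≟F j
      ... | yes i≡j = i≡j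
      ... | no  i≢j = ⊥-elim (to (indicator≡0⇔ (f j)) (zeros j (i≢j ∘ sym)) fj)
    single : ∃! _≡_ (T ∘ f) → ∃ (SingleUnit (indicator ∘ f))
    single (i , fi , at-i) =
      i , from (indicator≡1⇔ (f i)) fi , λ j j≢i → from (indicator≡0⇔ (f j)) (j≢i ∘ sym ∘ at-i)

T-≡ᵇ : ∀ {m n} → T (m ≡ᵇ n) ⇔ m ≡ n
T-≡ᵇ {m} {n} = mk⇔ (≡ᵇ⇒≡ m n) (≡⇒≡ᵇ m n)

T-exactlyOne : ∀ {k} (f : Fin k → Bool) → T (exactlyOne f) ⇔ ∃! _≡_ (T ∘ f)
T-exactlyOne f = mk⇔ (to (countF≡1⇔ f) ∘ to T-≡ᵇ) (from T-≡ᵇ ∘ from (countF≡1⇔ f))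

sumCounts≡1⇔ : ∀ {k l} (h : Fin k → Fin l → Bool) →
  sum (map (λ i → countF (h i)) (allFin k)) ≡ 1 ⇔ ∃! _≡_ (λ ((i , j) : Fin k × Fin l) → T (h i j))
sumCounts≡1⇔ {k} {l} h = mk⇔
  (λ e → unique (to (sum≡1⇔ _) (trans (sym (sum-over-allFin (countF ∘ h))) e)))
  (λ u → trans (sum-over-allFin (countF ∘ h)) (from (sum≡1⇔ _) (single u)))
  where
  unique : ∃ (SingleUnit (λ i → countF (h i))) → ∃! _≡_ (λ ((i , j) : Fin k × Fin l) → T (h i j))
  unique (i , one , zeros) with to (countF≡1⇔ (h i)) one
  ... | j , hij , at-j = (i , j) , hij , at-ij
    where
    at-ij : ∀ {p} → T (h (proj₁ p) (proj₂ p)) → (i , j) ≡ p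
    at-ij {i′ , j′} hp with i ≟F i′
    ... | yes refl = cong (i ,_) (at-j hp)
    ... | no  i≢i′ = ⊥-elim (to (countF≡0⇔ (h i′)) (zeros i′ (i≢i′ ∘ sym)) j′ hp)
  single : ∃! _≡_ (λ ((i , j) : Fin k × Fin l) → T (h i j)) → ∃ (SingleUnit (λ i → countF (h i)))
  single ((i , j) , hij , at-ij) =
    i , from (countF≡1⇔ (h i)) (j , hij , λ hij′ → proj₂ (×-≡,≡←≡ (at-ij hij′))) ,
    λ i′ i′≢i → from (countF≡0⇔ (h i′)) (λ j′ hij′ → i′≢i (sym (proj₁ (×-≡,≡←≡ (at-ij hij′)))))

∃!-cong : ∀ {X : Set} {P Q : X → Set} → (∀ x → P x ⇔ Q x) → ∃! _≡_ P ⇔ ∃! _≡_ Q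
∃!-cong e = mk⇔ (λ (x , px , at-x) → x , to (e x) px , at-x ∘ from (e _))
                (λ (x , qx , at-x) → x , from (e x) qx , at-x ∘ to (e _))

∃!-reindex : ∀ {X Y : Set} (e : X ↔ Y) {P : X → Set} → ∃! _≡_ P ⇔ ∃! _≡_ (P ∘ Inverse.from e)
∃!-reindex e {P} = mk⇔
  (λ (x , px , at-x) → to′ x , subst P (sym (from∘to x)) px ,
                       λ {y} py → trans (cong to′ (at-x py)) (to∘from y))
  (λ (y , py , at-y) → from′ y , py ,
                       λ {x} px → trans (cong from′ (at-y (subst P (sym (from∘to x)) px))) (from∘to x))
  where
  open Inverse e renaming (to to to′; from to from′; strictlyInverseˡ to to∘from; strictlyInverseʳ to from∘to)

-- Along the graph of g, a unique ⟨x , z⟩ with g x = ⟨a , z⟩ is a unique x whose g-image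
-- has first coordinate a: the second coordinate z is determined by x.
∃!-graph : ∀ {X Y Z : Set} (g : X → Y × Z) (a : Y) →
  ∃! _≡_ (λ ((x , z) : X × Z) → g x ≡ (a , z)) ⇔ ∃! _≡_ (λ x → proj₁ (g x) ≡ a)
∃!-graph g a = mk⇔
  (λ ((x , z) , gx≡az , at) → x , cong proj₁ gx≡az ,
     λ {x′} e → cong proj₁ (at (cong (_, proj₂ (g x′)) e)))
  (λ (x , e , at) → (x , proj₂ (g x)) , cong (_, proj₂ (g x)) e ,
     λ {(x′ , z′)} gx′≡az′ → let x≡x′ = at (cong proj₁ gx′≡az′) in
       ×-≡,≡→≡ (x≡x′ , trans (cong (proj₂ ∘ g) x≡x′) (cong proj₂ gx′≡az′)))

T-not : ∀ {b} → T (not b) ⇔ (¬ T b)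
T-not {true}  = mk⇔ (λ ()) (λ ¬t → ¬t _)
T-not {false} = mk⇔ (λ _ ()) _

T-ext : ∀ {a b} → T a ⇔ T b → a ≡ b
T-ext e = ⇔→≡ {z = true} (mk⇔ (to T-≡ ∘ to e ∘ from T-≡) (to T-≡ ∘ from e ∘ from T-≡))

T-⌊⌋ : ∀ {P : Set} (P? : Dec P) → T ⌊ P? ⌋ ⇔ P
T-⌊⌋ P? = mk⇔ toWitness fromWitness

T-pairEq : ∀ {k} {p q : Fin k × Fin k} → T (pairEq p q) ⇔ p ≡ q
T-pairEq {p = a , b} {c , d} = mk⇔
  (λ t → let (a≡c , b≡d) = to T-∧ t in ×-≡,≡→≡ (to (T-⌊⌋ (a ≟F c)) a≡c , to (T-⌊⌋ (b ≟F d)) b≡d))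
  (λ p≡q → let (a≡c , b≡d) = ×-≡,≡←≡ p≡q in from T-∧ (from (T-⌊⌋ (a ≟F c)) a≡c , from (T-⌊⌋ (b ≟F d)) b≡d))

entry-tabulate : ∀ {X : Set} {k} (f : Fin k → Fin k → X) i j →
                 lookup (lookup (tabulate λ i → tabulate (f i)) i) j ≡ f i j
entry-tabulate f i j = trans (cong (λ row → lookup row j) (lookup∘tabulate _ i)) (lookup∘tabulate _ j)

matrix-ext : ∀ {X : Set} {k} {A B : Vec (Vec X k) k} →
             (∀ i j → lookup (lookup A i) j ≡ lookup (lookup B i) j) → A ≡ B
matrix-ext {A = A} {B} h = begin
  A                                                        ≡⟨ tabulate∘lookup² A ⟨
  tabulate (λ i → tabulate (λ j → lookup (lookup A i) j))  ≡⟨ tabulate-cong (λ i → tabulate-cong (h i)) ⟩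
  tabulate (λ i → tabulate (λ j → lookup (lookup B i) j))  ≡⟨ tabulate∘lookup² B ⟩
  B                                                        ∎
  where
  open ≡-Reasoning
  tabulate∘lookup² : ∀ M → tabulate (λ i → tabulate (λ j → lookup (lookup M i) j)) ≡ M
  tabulate∘lookup² M = trans (tabulate-cong (λ i → tabulate∘lookup (lookup M i))) (tabulate∘lookup M)

T-exactlyOne-≟ : ∀ {k l} (g : Fin k → Fin l) (a : Fin l) →
                 T (exactlyOne (λ i → ⌊ g i ≟F a ⌋)) ⇔ ∃! _≡_ (λ i → g i ≡ a)
T-exactlyOne-≟ g a = begin
  T (exactlyOne (λ i → ⌊ g i ≟F a ⌋))  ∼⟨ T-exactlyOne _ ⟩
  ∃! _≡_ (λ i → T ⌊ g i ≟F a ⌋)        ∼⟨ ∃!-cong (λ i → T-⌊⌋ (g i ≟F a)) ⟩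
  ∃! _≡_ (λ i → g i ≡ a)                ∎
  where open EquationalReasoning {k = Kind.equivalence}

uniqueness : ∀ {X : Set} {P : X → Set} (u : ∃! _≡_ P) {y} → proj₁ u ≡ y ⇔ P y
uniqueness (x , px , at-x) {y} = mk⇔ (λ x≡y → subst _ x≡y px) at-x

T-∧³ : ∀ a b c → T (a ∧ b ∧ c) ⇔ (T a × T b × T c)
T-∧³ a b c = mk⇔
  (λ t → let (ta , tbc) = to (T-∧ {a} {b ∧ c}) t in ta , to (T-∧ {b} {c}) tbc)
  (λ (ta , tb , tc) → from (T-∧ {a} {b ∧ c}) (ta , from (T-∧ {b} {c}) (tb , tc)))

Σ-T-≡ : ∀ {X : Set} {b : X → Bool} {x y : X} {p : T (b x)} {q : T (b y)} →
        x ≡ y → _≡_ {A = Σ X (T ∘ b)} (x , p) (y , q)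
Σ-T-≡ refl = cong (_ ,_) (T-irrelevant _ _)

module Correspondence (n : ℕ) where

  -- Entry (i , j) of the block A_st, i.e. entry (s·n + i , t·n + j) of A.
  block : BMat (n * n) → Fin n → Fin n → Fin n → Fin n → Bool
  block A s t i j = entry A (combine s i) (combine t j)

  block-ext : ∀ {A B} → (∀ s t i j → block A s t i j ≡ block B s t i j) → A ≡ B
  block-ext {A} {B} h = matrix-ext at-combine
    where
    at-combine : ∀ r c → entry A r c ≡ entry B r c
    at-combine r c with s , i , refl ← combine-surjective {m = n} r | t , j , refl ← combine-surjective {m = n} c
      = h s t i j

  BlocksUnique : BMat (n * n) → Set
  BlocksUnique A = ∀ s t → ∃! _≡_ (λ ((i , j) : Fin n × Fin n) → T (block A s t i j))

  record InΣ (A : BMat (n * n)) : Set where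
    field
      rows    : ∀ r → ∃! _≡_ (λ c → T (entry A r c))
      columns : ∀ c → ∃! _≡_ (λ r → T (entry A r c))
      blocks  : BlocksUnique A

  record InΠ (P : PMat n) : Set where
    field
      rows    : ∀ s a → ∃! _≡_ (λ t → proj₁ (pentry P s t) ≡ a)
      columns : ∀ t b → ∃! _≡_ (λ s → proj₂ (pentry P s t) ≡ b)

  T-isSPermutationMatrix : ∀ A → T (isSPermutationMatrix n A) ⇔ InΣ A
  T-isSPermutationMatrix A = mk⇔
    (λ test → let (perm , blk) = to (T-∧ {permTest} {blocksTest}) test
                  (rw , cl)    = to (T-∧ {allF rowTest} {allF columnTest}) perm in record
      { rows    = λ r → to (T-exactlyOne (entry A r)) (to (T-allF {f = rowTest}) rw r)
      ; columns = λ c → to (T-exactlyOne (λ r → entry A r c)) (to (T-allF {f = columnTest}) cl c)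
      ; blocks  = λ s t → to (sumCounts≡1⇔ (block A s t))
                             (to T-≡ᵇ (to (T-allF {f = blockTest s}) (to (T-allF {f = allF ∘ blockTest}) blk s) t)) })
    (λ σ → let open InΣ σ in from (T-∧ {permTest} {blocksTest})
      ( from (T-∧ {allF rowTest} {allF columnTest})
          ( from (T-allF {f = rowTest}) (λ r → from (T-exactlyOne (entry A r)) (rows r))
          , from (T-allF {f = columnTest}) (λ c → from (T-exactlyOne (λ r → entry A r c)) (columns c)))
      , from (T-allF {f = allF ∘ blockTest}) (λ s → from (T-allF {f = blockTest s}) (λ t →
          from T-≡ᵇ (from (sumCounts≡1⇔ (block A s t)) (blocks s t))))))
    where
    rowTest columnTest : Fin (n * n) → Bool
    rowTest r    = exactlyOne (λ c → entry A r c)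
    columnTest c = exactlyOne (λ r → entry A r c)
    blockTest : Fin n → Fin n → Bool
    blockTest s t = blockCount n A s t ≡ᵇ 1
    permTest blocksTest : Bool
    permTest   = allF rowTest ∧ allF columnTest
    blocksTest = allF (allF ∘ blockTest)

  T-isΠ : ∀ P → T (isΠ n P) ⇔ InΠ P
  T-isΠ P = mk⇔
    (λ test → let (rw , cl) = to (T-∧ {allF (allF ∘ rowTest)} {allF (allF ∘ columnTest)}) test in record
      { rows    = λ s a → to (T-exactlyOne-≟ (proj₁ ∘ pentry P s) a)
                             (to (T-allF {f = rowTest s}) (to (T-allF {f = allF ∘ rowTest}) rw s) a)
      ; columns = λ t b → to (T-exactlyOne-≟ (λ s → proj₂ (pentry P s t)) b)
                             (to (T-allF {f = columnTest t}) (to (T-allF {f = allF ∘ columnTest}) cl t) b) })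
    (λ π → let open InΠ π in from (T-∧ {allF (allF ∘ rowTest)} {allF (allF ∘ columnTest)})
      ( from (T-allF {f = allF ∘ rowTest}) (λ s → from (T-allF {f = rowTest s}) (λ a →
          from (T-exactlyOne-≟ (proj₁ ∘ pentry P s) a) (rows s a)))
      , from (T-allF {f = allF ∘ columnTest}) (λ t → from (T-allF {f = columnTest t}) (λ b →
          from (T-exactlyOne-≟ (λ s → proj₂ (pentry P s t)) b) (columns t b)))))
    where
    rowTest columnTest : Fin n → Fin n → Bool
    rowTest s a    = exactlyOne (λ t → ⌊ proj₁ (pentry P s t) ≟F a ⌋)
    columnTest t b = exactlyOne (λ s → ⌊ proj₂ (pentry P s t) ≟F b ⌋)

  -- The n²×n² 0/1 matrix encoded by P: block A_st has its only 1 at position P_st.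
  expand : PMat n → BMat (n * n)
  expand P = tabulate λ r → tabulate λ c → cell (remQuot n r) (remQuot n c)
    where
    cell : Fin n × Fin n → Fin n × Fin n → Bool
    cell (s , i) (t , j) = pairEq (pentry P s t) (i , j)

  T-block-expand : ∀ P s t i j → T (block (expand P) s t i j) ⇔ pentry P s t ≡ (i , j)
  T-block-expand P s t i j = subst (λ b → T b ⇔ pentry P s t ≡ (i , j)) (sym block≡) T-pairEq
    where
    block≡ : block (expand P) s t i j ≡ pairEq (pentry P s t) (i , j)
    block≡ = trans (entry-tabulate _ (combine s i) (combine t j))
      (cong₂ (λ (s′ , i′) (t′ , j′) → pairEq (pentry P s′ t′) (i′ , j′)) (remQuot-combine s i) (remQuot-combine t j))

  expand-blocksUnique : ∀ P → BlocksUnique (expand P)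
  expand-blocksUnique P s t =
    pentry P s t , from (T-block-expand P s t _ _) refl , λ {(i , j)} → to (T-block-expand P s t i j)

  collapse : (A : BMat (n * n)) → BlocksUnique A → PMat n
  collapse A unique = tabulate λ s → tabulate λ t → proj₁ (unique s t)

  expand-collapse : ∀ A (unique : BlocksUnique A) → expand (collapse A unique) ≡ A
  expand-collapse A unique = block-ext λ s t i j → T-ext (begin
    T (block (expand (collapse A unique)) s t i j)  ∼⟨ T-block-expand (collapse A unique) s t i j ⟩
    pentry (collapse A unique) s t ≡ (i , j)        ≡⟨ cong (_≡ (i , j)) (entry-tabulate _ s t) ⟩
    proj₁ (unique s t) ≡ (i , j)                    ∼⟨ uniqueness (unique s t) ⟩
    T (block A s t i j)                             ∎)
    where
    open EquationalReasoning {k = Kind.equivalence}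

  collapse-expand : ∀ P (unique : BlocksUnique (expand P)) → collapse (expand P) unique ≡ P
  collapse-expand P unique = matrix-ext λ s t →
    trans (entry-tabulate _ s t) (from (uniqueness (unique s t)) (from (T-block-expand P s t _ _) refl))

  expand-row⇔ : ∀ P s a → ∃! _≡_ (λ c → T (entry (expand P) (combine s a) c))
                         ⇔ ∃! _≡_ (λ t → proj₁ (pentry P s t) ≡ a)
  expand-row⇔ P s a = begin
    ∃! _≡_ (λ c → T (entry (expand P) (combine s a) c))  ∼⟨ ∃!-reindex (*↔× {m = n}) ⟩
    ∃! _≡_ (λ (t , j) → T (block (expand P) s t a j))     ∼⟨ ∃!-cong (λ (t , j) → T-block-expand P s t a j) ⟩
    ∃! _≡_ (λ (t , j) → pentry P s t ≡ (a , j))           ∼⟨ ∃!-graph (pentry P s) a ⟩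
    ∃! _≡_ (λ t → proj₁ (pentry P s t) ≡ a)               ∎
    where open EquationalReasoning {k = Kind.equivalence}

  expand-column⇔ : ∀ P t b → ∃! _≡_ (λ r → T (entry (expand P) r (combine t b)))
                            ⇔ ∃! _≡_ (λ s → proj₂ (pentry P s t) ≡ b)
  expand-column⇔ P t b = begin
    ∃! _≡_ (λ r → T (entry (expand P) r (combine t b)))  ∼⟨ ∃!-reindex (*↔× {m = n}) ⟩
    ∃! _≡_ (λ (s , i) → T (block (expand P) s t i b))     ∼⟨ ∃!-cong (λ (s , i) → T-block-expand P s t i b) ⟩
    ∃! _≡_ (λ (s , i) → pentry P s t ≡ (i , b))           ∼⟨ ∃!-cong (λ _ → mk⇔ (cong swap) (cong swap)) ⟩
    ∃! _≡_ (λ (s , i) → swap (pentry P s t) ≡ (b , i))    ∼⟨ ∃!-graph (λ s → swap (pentry P s t)) b ⟩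
    ∃! _≡_ (λ s → proj₂ (pentry P s t) ≡ b)               ∎
    where open EquationalReasoning {k = Kind.equivalence}

  expand-InΣ⇔InΠ : ∀ P → InΣ (expand P) ⇔ InΠ P
  expand-InΣ⇔InΠ P = mk⇔
    (λ σ → record
      { rows    = λ s a → to (expand-row⇔ P s a) (InΣ.rows σ (combine s a))
      ; columns = λ t b → to (expand-column⇔ P t b) (InΣ.columns σ (combine t b)) })
    (λ π → record
      { rows    = rows π
      ; columns = columns π
      ; blocks  = expand-blocksUnique P })
    where
    rows : InΠ P → ∀ r → ∃! _≡_ (λ c → T (entry (expand P) r c))
    rows π r with s , a , refl ← combine-surjective {m = n} r = from (expand-row⇔ P s a) (InΠ.rows π s a)
    columns : InΠ P → ∀ c → ∃! _≡_ (λ r → T (entry (expand P) r c))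
    columns π c with t , b , refl ← combine-surjective {m = n} c = from (expand-column⇔ P t b) (InΠ.columns π t b)

  DisjointΣ : BMat (n * n) → BMat (n * n) → Set
  DisjointΣ A B = ∀ r c → ¬ (T (entry A r c) × T (entry B r c))

  DisjointΠ : PMat n → PMat n → Set
  DisjointΠ P Q = ∀ s t → pentry P s t ≢ pentry Q s t

  T-disjointB : ∀ A B → T (disjointB A B) ⇔ DisjointΣ A B
  T-disjointB A B = mk⇔
    (λ d r c → to T-not (to (T-allF {f = clash r}) (to (T-allF {f = allF ∘ clash}) d r) c) ∘ from T-∧)
    (λ h → from (T-allF {f = allF ∘ clash}) λ r → from (T-allF {f = clash r}) λ c →
             from T-not (h r c ∘ to (T-∧ {entry A r c} {entry B r c})))
    where
    clash : Fin (n * n) → Fin (n * n) → Bool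
    clash r c = not (entry A r c ∧ entry B r c)

  T-disjointΠ : ∀ P Q → T (disjointΠ P Q) ⇔ DisjointΠ P Q
  T-disjointΠ P Q = mk⇔
    (λ d s t → to T-not (to (T-allF {f = clash s}) (to (T-allF {f = allF ∘ clash}) d s) t) ∘ from T-pairEq)
    (λ h → from (T-allF {f = allF ∘ clash}) λ s → from (T-allF {f = clash s}) λ t →
             from T-not (h s t ∘ to T-pairEq))
    where
    clash : Fin n → Fin n → Bool
    clash s t = not (pairEq (pentry P s t) (pentry Q s t))

  -- expand P and expand Q are disjoint exactly when P and Q are: a common 1 of the
  -- expansions sits in block (s , t) at position P_st = Q_st.
  expand-disjoint⇔ : ∀ P Q → DisjointΣ (expand P) (expand Q) ⇔ DisjointΠ P Q
  expand-disjoint⇔ P Q = mk⇔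
    (λ disj s t P≡Q → let (i , j) = pentry P s t in
       disj (combine s i) (combine t j)
            (from (T-block-expand P s t i j) refl , from (T-block-expand Q s t i j) (sym P≡Q)))
    common
    where
    common : DisjointΠ P Q → DisjointΣ (expand P) (expand Q)
    common disj r c (x , y) with s , i , refl ← combine-surjective {m = n} r
                              | t , j , refl ← combine-surjective {m = n} c
      = disj s t (trans (to (T-block-expand P s t i j) x) (sym (to (T-block-expand Q s t i j) y)))

  collapse-InΠ : ∀ {A} (σ : InΣ A) → InΠ (collapse A (InΣ.blocks σ))
  collapse-InΠ {A} σ = to (expand-InΣ⇔InΠ _) (subst InΣ (sym (expand-collapse A (InΣ.blocks σ))) σ)

  collapse-disjoint : ∀ {A B} (σA : InΣ A) (σB : InΣ B) → DisjointΣ A B →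
                      DisjointΠ (collapse A (InΣ.blocks σA)) (collapse B (InΣ.blocks σB))
  collapse-disjoint {A} {B} σA σB disj =
    to (expand-disjoint⇔ (collapse A uA) (collapse B uB))
       (subst₂ DisjointΣ (sym (expand-collapse A uA)) (sym (expand-collapse B uB)) disj)
    where
    uA = InΣ.blocks σA
    uB = InΣ.blocks σB

  isDisjointΣPair : BMat (n * n) × BMat (n * n) → Bool
  isDisjointΣPair (A , B) = isSPermutationMatrix n A ∧ isSPermutationMatrix n B ∧ disjointB A B

  isDisjointΠPair : PMat n × PMat n → Bool
  isDisjointΠPair (P , Q) = isΠ n P ∧ isΠ n Q ∧ disjointΠ P Q

  ΣPairs ΠPairs : Set
  ΣPairs = Σ (BMat (n * n) × BMat (n * n)) (T ∘ isDisjointΣPair)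
  ΠPairs = Σ (PMat n × PMat n) (T ∘ isDisjointΠPair)

  T-isDisjointΣPair : ∀ A B → T (isDisjointΣPair (A , B)) ⇔ (InΣ A × InΣ B × DisjointΣ A B)
  T-isDisjointΣPair A B = mk⇔
    (λ h → let (sA , sB , disj) = to (T-∧³ _ _ (disjointB A B)) h in
      to (T-isSPermutationMatrix A) sA , to (T-isSPermutationMatrix B) sB , to (T-disjointB A B) disj)
    (λ (σA , σB , disj) → from (T-∧³ (isSPermutationMatrix n A) (isSPermutationMatrix n B) (disjointB A B))
      (from (T-isSPermutationMatrix A) σA , from (T-isSPermutationMatrix B) σB , from (T-disjointB A B) disj))

  T-isDisjointΠPair : ∀ P Q → T (isDisjointΠPair (P , Q)) ⇔ (InΠ P × InΠ Q × DisjointΠ P Q)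
  T-isDisjointΠPair P Q = mk⇔
    (λ h → let (sP , sQ , disj) = to (T-∧³ _ _ (disjointΠ P Q)) h in
      to (T-isΠ P) sP , to (T-isΠ Q) sQ , to (T-disjointΠ P Q) disj)
    (λ (πP , πQ , disj) → from (T-∧³ (isΠ n P) (isΠ n Q) (disjointΠ P Q))
      (from (T-isΠ P) πP , from (T-isΠ Q) πQ , from (T-disjointΠ P Q) disj))

  collapse-pair : ΣPairs → ΠPairs
  collapse-pair ((A , B) , h) =
    let (σA , σB , disj) = to (T-isDisjointΣPair A B) h
    in (collapse A (InΣ.blocks σA) , collapse B (InΣ.blocks σB)) ,
       from (T-isDisjointΠPair _ _) (collapse-InΠ σA , collapse-InΠ σB , collapse-disjoint σA σB disj)

  expand-pair : ΠPairs → ΣPairs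
  expand-pair ((P , Q) , h) =
    let (πP , πQ , disj) = to (T-isDisjointΠPair P Q) h
    in (expand P , expand Q) ,
       from (T-isDisjointΣPair _ _)
         (from (expand-InΣ⇔InΠ P) πP , from (expand-InΣ⇔InΠ Q) πQ , from (expand-disjoint⇔ P Q) disj)

  -- The two maps are mutually inverse (the Boolean membership proofs are irrelevant).
  collapse∘expand : ∀ y → collapse-pair (expand-pair y) ≡ y
  collapse∘expand y@((P , Q) , _) =
    let ((A , B) , h) = expand-pair y ; (σA , σB , _) = to (T-isDisjointΣPair A B) h
    in Σ-T-≡ {b = isDisjointΠPair}
         (cong₂ _,_ (collapse-expand P (InΣ.blocks σA)) (collapse-expand Q (InΣ.blocks σB)))

  expand∘collapse : ∀ x → expand-pair (collapse-pair x) ≡ x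
  expand∘collapse ((A , B) , h) =
    let (σA , σB , _) = to (T-isDisjointΣPair A B) h
    in Σ-T-≡ {b = isDisjointΣPair}
         (cong₂ _,_ (expand-collapse A (InΣ.blocks σA)) (expand-collapse B (InΣ.blocks σB)))

  pairs-bijection : ΣPairs ⤖ ΠPairs
  pairs-bijection = ↔⇒⤖ (mk↔ₛ′ collapse-pair expand-pair collapse∘expand expand∘collapse)

corollary3 : (n : ℕ) → 2 ≤ n →
    (Σ (BMat (n * n) × BMat (n * n)) (λ { (A , B) →
        T (isSPermutationMatrix n A ∧ isSPermutationMatrix n B ∧ disjointB A B) }))
    ⤖
    (Σ (PMat n × PMat n) (λ { (P , Q) →
        T (isΠ n P ∧ isΠ n Q ∧ disjointΠ P Q) }))
-- The correspondence exists for every n.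
corollary3 n _ = Correspondence.pairs-bijection n
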